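{- Let $n \geq 2$ and let $k$ be an integer with $1 \leq k \leq n$. Then \[ \frac{1}{F_n} \binom{n}{k}_F \binom{n}{k-1}_F = \binom{n-1}{k-1}_F^2 + \binom{n-1}{k}_F \binom{n-1}{k-2}_F. \]
   Context: $F_n$ denotes the Fibonacci numbers: $F_0 = 0$, $F_1 = 1$, $F_n = F_{n-1} + F_{n-2}$ for $n \geq 2$. Write $F_n! = F_n F_{n-1} \cdots F_2 F_1$, with $F_0! = 1$. The fibonomial coefficient is $\binom{n}{k}_F = \frac{F_n!}{F_k!\,F_{n-k}!}$ for $0 \leq k \leq n$, and $\binom{n}{k}_F = 0$ if $k < 0$ or $k > n$. The left-hand side is the FiboNarayana number $N_{n,k,F}$. -}

module Defs where

open import Data.Nat using (ℕ; zero; suc; _+_; _*_; _∸_; _≤_; _≤?_; NonZero)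
open import Data.Nat.Properties using (m*n≢0)
open import Data.Nat.DivMod using (_/_)
open import Data.Integer using (ℤ; +_; -[1+_])
open import Relation.Nullary using (yes; no)

F : ℕ → ℕ
F zero = 0
F (suc zero) = 1
F (suc (suc n)) = F (suc n) + F n

F! : ℕ → ℕ
F! zero = 1
F! (suc n) = F (suc n) * F! n

F-suc-nonZero : ∀ n → NonZero (F (suc n))
F-suc-nonZero zero = _
F-suc-nonZero (suc n) with F (suc n) | F-suc-nonZero n
... | suc a | _ = _

F!-nonZero : ∀ n → NonZero (F! n)
F!-nonZero zero = _
F!-nonZero (suc n) = m*n≢0 (F (suc n)) (F! n) {{F-suc-nonZero n}} {{F!-nonZero n}}

fibonomialℕ : ℕ → ℕ → ℕ
fibonomialℕ n k = _/_ (F! n) (F! k * F! (n ∸ k))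
  {{m*n≢0 (F! k) (F! (n ∸ k)) {{F!-nonZero k}} {{F!-nonZero (n ∸ k)}}}}

fibonomial : ℕ → ℤ → ℕ
fibonomial n -[1+ _ ] = 0
fibonomial n (+ k) with k ≤? n
... | yes _ = fibonomialℕ n k
... | no _ = 0

-- Put n = a + b + 1, k = a + 1 and X = C(n-1,k-1) = C(a+b, a). Dividing factorials shows that each of
-- the four other fibonomials is X times a ratio of Fibonacci numbers:
--   C(n,k) = X F(n)/F(a+1),  C(n,k-1) = X F(n)/F(b+1),
--   C(n-1,k) = X F(b)/F(a+1),  C(n-1,k-2) = X F(a)/F(b+1).
-- The identity then reduces to the addition formula F(n) = F(a+1) F(b+1) + F(a) F(b).
module Submission where

open import Defs
open import Data.Nat using (ℕ; zero; suc; _*_; _+_; _∸_; _≤_; _<_; _≤?_; s≤s; NonZero)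
open import Data.Nat.Properties
open import Data.Nat.DivMod using (_/_; m*n/n≡m)
open import Data.Nat.Tactic.RingSolver using (solve-∀)
open import Data.Integer using (ℤ; +_; -[1+_]; +≤+) renaming (_≤_ to _≤ℤ_; _-_ to _-ℤ_)
open import Relation.Binary.PropositionalEquality using (_≡_; refl; sym; trans; cong; cong₂; module ≡-Reasoning)
open import Relation.Nullary using (yes; no)
open import Relation.Nullary.Negation using (contradiction)

open ≡-Reasoning

F-+ : ∀ a b → F (suc (a + b)) ≡ F (suc a) * F (suc b) + F a * F b
F-+ zero    b = sym (trans (+-identityʳ _) (+-identityʳ _))
F-+ (suc a) b = begin
  F (suc (suc a + b))                              ≡⟨ cong (λ t → F (suc t)) (sym (+-suc a b)) ⟩
  F (suc (a + suc b))                              ≡⟨ F-+ a (suc b) ⟩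
  F (suc a) * (F (suc b) + F b) + F a * F (suc b)  ≡⟨ regroup (F (suc a)) (F a) (F (suc b)) (F b) ⟩
  (F (suc a) + F a) * F (suc b) + F (suc a) * F b  ∎
  where
  regroup : ∀ p q r s → p * (r + s) + q * r ≡ (p + q) * r + p * s
  regroup = solve-∀

-- fibBinom a b is C(a+b, a)_F, defined by the fibonomial Pascal rule
-- C(n,k) = F(k+1) C(n-1,k) + F(n-k-1) C(n-1,k-1), so that it is visibly a natural number.
fibBinom : ℕ → ℕ → ℕ
fibBinom zero    b       = 1
fibBinom (suc a) zero    = 1
fibBinom (suc a) (suc b) = F (suc (suc a)) * fibBinom (suc a) b + F b * fibBinom a (suc b)

fibBinom-*-F! : ∀ a b → fibBinom a b * (F! a * F! b) ≡ F! (a + b)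
fibBinom-*-F! zero    b    = trans (*-identityˡ _) (+-identityʳ _)
fibBinom-*-F! (suc a) zero = trans (*-identityˡ _) (trans (*-identityʳ _) (cong F! (sym (+-identityʳ (suc a)))))
fibBinom-*-F! (suc a) (suc b) = begin
  (p * g₁ + q * g₂) * (F! (suc a) * F! (suc b))
    ≡⟨ regroup p q r s (F! a) (F! b) g₁ g₂ ⟩
  p * s * (g₁ * (F! (suc a) * F! b)) + r * q * (g₂ * (F! a * F! (suc b)))
    ≡⟨ cong₂ (λ u v → p * s * u + r * q * v) (fibBinom-*-F! (suc a) b) (fibBinom-*-F! a (suc b)) ⟩
  p * s * F! (suc (a + b)) + r * q * F! (a + suc b)
    ≡⟨ cong (λ t → p * s * F! (suc (a + b)) + r * q * F! t) (+-suc a b) ⟩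
  p * s * F! (suc (a + b)) + r * q * F! (suc (a + b))
    ≡⟨ sym (*-distribʳ-+ (F! (suc (a + b))) (p * s) (r * q)) ⟩
  (p * s + r * q) * F! (suc (a + b))
    ≡⟨ cong (_* F! (suc (a + b))) (sym (F-+ (suc a) b)) ⟩
  F! (suc (suc (a + b)))
    ≡⟨ cong (λ t → F! (suc t)) (sym (+-suc a b)) ⟩
  F! (suc a + suc b) ∎
  where
  p = F (suc (suc a)); q = F b; r = F (suc a); s = F (suc b)
  g₁ = fibBinom (suc a) b; g₂ = fibBinom a (suc b)
  regroup : ∀ p q r s x y g₁ g₂ →
    (p * g₁ + q * g₂) * ((r * x) * (s * y)) ≡ p * s * (g₁ * (r * x * y)) + r * q * (g₂ * (x * (s * y)))
  regroup = solve-∀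

F!*F!-nonZero : ∀ a b → NonZero (F! a * F! b)
F!*F!-nonZero a b = m*n≢0 (F! a) (F! b) {{F!-nonZero a}} {{F!-nonZero b}}

/-exact : ∀ {m n} o .{{_ : NonZero n}} → m ≡ o * n → m / n ≡ o
/-exact {n = n} o refl = m*n/n≡m o n

fibonomialℕ-fibBinom : ∀ a b → fibonomialℕ (a + b) a ≡ fibBinom a b
fibonomialℕ-fibBinom a b = /-exact (fibBinom a b) {{F!*F!-nonZero a (a + b ∸ a)}} (sym (begin
  fibBinom a b * (F! a * F! (a + b ∸ a))  ≡⟨ cong (λ t → fibBinom a b * (F! a * F! t)) (m+n∸m≡n a b) ⟩
  fibBinom a b * (F! a * F! b)            ≡⟨ fibBinom-*-F! a b ⟩
  F! (a + b)                              ∎))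

fibonomial-inRange : ∀ {n k} → k ≤ n → fibonomial n (+ k) ≡ fibonomialℕ n k
fibonomial-inRange {n} {k} k≤n with k ≤? n
... | yes _   = refl
... | no  k≰n = contradiction k≤n k≰n

fibonomial-outOfRange : ∀ {n k} → n < k → fibonomial n (+ k) ≡ 0
fibonomial-outOfRange {n} {k} n<k with k ≤? n
... | yes k≤n = contradiction k≤n (<⇒≱ n<k)
... | no  _   = refl

fibonomial-fibBinom : ∀ a b → fibonomial (a + b) (+ a) ≡ fibBinom a b
fibonomial-fibBinom a b = trans (fibonomial-inRange (m≤m+n a b)) (fibonomialℕ-fibBinom a b)

*-F!-cancelʳ : ∀ a b {u v} → u * (F! a * F! b) ≡ v * (F! a * F! b) → u ≡ v
*-F!-cancelʳ a b = *-cancelʳ-≡ _ _ (F! a * F! b) {{F!*F!-nonZero a b}}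

fibBinom-*-F-*-F! : ∀ a b → fibBinom a b * F (suc (a + b)) * (F! a * F! b) ≡ F! (suc (a + b))
fibBinom-*-F-*-F! a b = begin
  fibBinom a b * F (suc (a + b)) * (F! a * F! b)   ≡⟨ regroup (fibBinom a b) (F (suc (a + b))) (F! a * F! b) ⟩
  F (suc (a + b)) * (fibBinom a b * (F! a * F! b)) ≡⟨ cong (F (suc (a + b)) *_) (fibBinom-*-F! a b) ⟩
  F! (suc (a + b))                                 ∎
  where
  regroup : ∀ g r x → g * r * x ≡ r * (g * x)
  regroup = solve-∀

fibBinom-absorbˡ : ∀ a b → fibBinom (suc a) b * F (suc a) ≡ fibBinom a b * F (suc (a + b))
fibBinom-absorbˡ a b = *-F!-cancelʳ a b (begin
  fibBinom (suc a) b * F (suc a) * (F! a * F! b)  ≡⟨ regroup (fibBinom (suc a) b) (F (suc a)) (F! a) (F! b) ⟩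
  fibBinom (suc a) b * (F! (suc a) * F! b)        ≡⟨ fibBinom-*-F! (suc a) b ⟩
  F! (suc (a + b))                                ≡⟨ sym (fibBinom-*-F-*-F! a b) ⟩
  fibBinom a b * F (suc (a + b)) * (F! a * F! b)  ∎)
  where
  regroup : ∀ g r x y → g * r * (x * y) ≡ g * (r * x * y)
  regroup = solve-∀

fibBinom-absorbʳ : ∀ a b → fibBinom a (suc b) * F (suc b) ≡ fibBinom a b * F (suc (a + b))
fibBinom-absorbʳ a b = *-F!-cancelʳ a b (begin
  fibBinom a (suc b) * F (suc b) * (F! a * F! b)  ≡⟨ regroup (fibBinom a (suc b)) (F (suc b)) (F! a) (F! b) ⟩
  fibBinom a (suc b) * (F! a * F! (suc b))        ≡⟨ fibBinom-*-F! a (suc b) ⟩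
  F! (a + suc b)                                  ≡⟨ cong F! (+-suc a b) ⟩
  F! (suc (a + b))                                ≡⟨ sym (fibBinom-*-F-*-F! a b) ⟩
  fibBinom a b * F (suc (a + b)) * (F! a * F! b)  ∎)
  where
  regroup : ∀ g s x y → g * s * (x * y) ≡ g * (x * (s * y))
  regroup = solve-∀

fibonomial-suc-absorbˡ : ∀ a b →
  fibonomial (suc (a + b)) (+ suc a) * F (suc a) ≡ fibBinom a b * F (suc (a + b))
fibonomial-suc-absorbˡ a b =
  trans (cong (_* F (suc a)) (fibonomial-fibBinom (suc a) b)) (fibBinom-absorbˡ a b)

fibonomial-suc-absorbʳ : ∀ a b →
  fibonomial (suc (a + b)) (+ a) * F (suc b) ≡ fibBinom a b * F (suc (a + b))
fibonomial-suc-absorbʳ a b = begin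
  fibonomial (suc (a + b)) (+ a) * F (suc b)  ≡⟨ cong (λ m → fibonomial m (+ a) * F (suc b)) (sym (+-suc a b)) ⟩
  fibonomial (a + suc b) (+ a) * F (suc b)    ≡⟨ cong (_* F (suc b)) (fibonomial-fibBinom a (suc b)) ⟩
  fibBinom a (suc b) * F (suc b)              ≡⟨ fibBinom-absorbʳ a b ⟩
  fibBinom a b * F (suc (a + b))              ∎

fibonomial-next : ∀ a b → fibonomial (a + b) (+ suc a) * F (suc a) ≡ fibBinom a b * F b
fibonomial-next a zero = begin
  fibonomial (a + 0) (+ suc a) * F (suc a)  ≡⟨ cong (_* F (suc a)) (fibonomial-outOfRange (s≤s (≤-reflexive (+-identityʳ a)))) ⟩
  0                                         ≡⟨ sym (*-zeroʳ (fibBinom a 0)) ⟩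
  fibBinom a 0 * F 0                        ∎
fibonomial-next a (suc b) = begin
  fibonomial (a + suc b) (+ suc a) * F (suc a)    ≡⟨ cong (λ m → fibonomial m (+ suc a) * F (suc a)) (+-suc a b) ⟩
  fibonomial (suc (a + b)) (+ suc a) * F (suc a)  ≡⟨ fibonomial-suc-absorbˡ a b ⟩
  fibBinom a b * F (suc (a + b))                  ≡⟨ sym (fibBinom-absorbʳ a b) ⟩
  fibBinom a (suc b) * F (suc b)                  ∎

fibonomial-prev : ∀ a b → fibonomial (a + b) (+ suc a -ℤ + 2) * F (suc b) ≡ fibBinom a b * F a
fibonomial-prev zero    b = sym (*-zeroʳ (fibBinom 0 b))
fibonomial-prev (suc a) b = begin
  fibonomial (suc (a + b)) (+ a) * F (suc b)  ≡⟨ fibonomial-suc-absorbʳ a b ⟩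
  fibBinom a b * F (suc (a + b))              ≡⟨ sym (fibBinom-absorbˡ a b) ⟩
  fibBinom (suc a) b * F (suc a)              ∎

-- Over ℚ the hypotheses say u = X r / p, v = X r / q, s = X f / p, t = X e / q and r = p q + e f.
cross-multiplied-identity : ∀ {r} u v s t X p q e f .{{_ : NonZero (p * q)}} →
  u * p ≡ X * r → v * q ≡ X * r → s * p ≡ X * f → t * q ≡ X * e → r ≡ p * q + e * f →
  u * v ≡ r * (X * X + s * t)
cross-multiplied-identity {r} u v s t X p q e f up vq sp tq r≡ =
  *-cancelʳ-≡ _ _ (p * q) (begin
    u * v * (p * q)                            ≡⟨ regroupˡ u v p q ⟩
    (u * p) * (v * q)                          ≡⟨ cong₂ _*_ up vq ⟩
    (X * r) * (X * r)                          ≡⟨ cong (λ x → X * r * (X * x)) r≡ ⟩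
    (X * r) * (X * (p * q + e * f))            ≡⟨ regroupʳ X r p q e f ⟩
    r * (X * X * (p * q) + (X * f) * (X * e))  ≡⟨ cong₂ (λ x y → r * (X * X * (p * q) + x * y)) (sym sp) (sym tq) ⟩
    r * (X * X * (p * q) + (s * p) * (t * q))  ≡⟨ regroupᶜ r X s t p q ⟩
    r * (X * X + s * t) * (p * q)              ∎)
  where
  regroupˡ : ∀ u v p q → u * v * (p * q) ≡ (u * p) * (v * q)
  regroupˡ = solve-∀
  regroupʳ : ∀ X r p q e f → (X * r) * (X * (p * q + e * f)) ≡ r * (X * X * (p * q) + (X * f) * (X * e))
  regroupʳ = solve-∀
  regroupᶜ : ∀ r X s t p q → r * (X * X * (p * q) + (s * p) * (t * q)) ≡ r * (X * X + s * t) * (p * q)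
  regroupᶜ = solve-∀

fiboNarayana : ∀ a b →
  fibonomial (suc (a + b)) (+ suc a) * fibonomial (suc (a + b)) (+ a)
    ≡ F (suc (a + b)) * (fibonomial (a + b) (+ a) * fibonomial (a + b) (+ a)
                         + fibonomial (a + b) (+ suc a) * fibonomial (a + b) (+ suc a -ℤ + 2))
fiboNarayana a b rewrite fibonomial-fibBinom a b =
  cross-multiplied-identity
    (fibonomial (suc (a + b)) (+ suc a)) (fibonomial (suc (a + b)) (+ a))
    (fibonomial (a + b) (+ suc a)) (fibonomial (a + b) (+ suc a -ℤ + 2))
    (fibBinom a b) (F (suc a)) (F (suc b)) (F a) (F b) {{m*n≢0 _ _ {{F-suc-nonZero a}} {{F-suc-nonZero b}}}}
    (fibonomial-suc-absorbˡ a b) (fibonomial-suc-absorbʳ a b)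
    (fibonomial-next a b) (fibonomial-prev a b) (F-+ a b)

theorem2 : (n : ℕ) → (k : ℤ) → 2 ≤ n → ℤ.pos 1 ≤ℤ k → k ≤ℤ ℤ.pos n →
    fibonomial n k * fibonomial n (k -ℤ ℤ.pos 1)
      ≡ F n * (fibonomial (n ∸ 1) (k -ℤ ℤ.pos 1) * fibonomial (n ∸ 1) (k -ℤ ℤ.pos 1)
               + fibonomial (n ∸ 1) k * fibonomial (n ∸ 1) (k -ℤ ℤ.pos 2))
theorem2 (suc m) (+ suc a) _ _ (+≤+ (s≤s a≤m)) with m ∸ a | m+[n∸m]≡n a≤m
... | b | refl = fiboNarayana a b
theorem2 zero    (+ suc a) _ _          (+≤+ ())
theorem2 n       (+ zero)  _ (+≤+ ()) _
theorem2 n       -[1+ _ ]  _ ()       _
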